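{- Let $L$ be a linear order with $L\cong\omega^\delta\times L'$ for some $\delta\in\{+,-\}$ and some linear order $L'$ with $\mathrm{rk}(L')>0$. Then $L^{(1)}\cong\omega^\delta\times L''$ for some linear order $L''$.
   Context: $A\times B:=\sum_{a\in A}B$ (lexicographic product, first coordinate dominant); $\omega^+:=\omega$, $\omega^-:=\omega^*$ ($\omega$ reversed). Hausdorff derivative and rank: $\sim_0$ is equality on $L$; for $\alpha>0$ and $x<y$, $x\sim_\alpha y$ iff for some $\beta<\alpha$ only finitely many $\sim_\beta$-classes meet $[x,y]$. The $\sim_\alpha$-classes are convex and $L^{(\alpha)}$ denotes the set of these classes with the induced order (so $L^{(1)}$ identifies points with finitely many points between them). $\mathrm{rk}(L)$ is the least $\alpha$ with $L^{(\alpha)}$ finite ($\infty$ if none). -}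

module Defs where

open import Level using (0ℓ)
open import Data.Nat as ℕ using (ℕ)
open import Data.Product using (Σ; ∃; _×_; _,_)
open import Data.Sum using (_⊎_)
open import Data.List using (List)
open import Data.List.Relation.Unary.Any using (Any)
open import Relation.Nullary using (¬_)
open import Relation.Binary.Core using (Rel)
open import Relation.Binary.Structures using (IsStrictTotalOrder)
open import Relation.Binary.PropositionalEquality using (_≡_)

-- No laws are bundled, so that derived structures such
-- as the Hausdorff derivative can be built without proofs; linearity is
-- the separate predicate IsLinear below.
record Ord : Set₁ where
  field
    Carrier : Set
    _≈_     : Rel Carrier 0ℓ
    _<_     : Rel Carrier 0ℓ

open Ord public

IsLinear : Ord → Set
IsLinear L = IsStrictTotalOrder (_≈_ L) (_<_ L)

record _≅_ (A B : Ord) : Set where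
  field
    to       : Carrier A → Carrier B
    ≈⇔       : ∀ x y → (_≈_ A x y → _≈_ B (to x) (to y)) × (_≈_ B (to x) (to y) → _≈_ A x y)
    <⇔       : ∀ x y → (_<_ A x y → _<_ B (to x) (to y)) × (_<_ B (to x) (to y) → _<_ A x y)
    surj     : ∀ b → ∃ λ a → _≈_ B (to a) b

ω : Ord
ω = record { Carrier = ℕ ; _≈_ = _≡_ ; _<_ = ℕ._<_ }

ω* : Ord
ω* = record { Carrier = ℕ ; _≈_ = _≡_ ; _<_ = λ m n → n ℕ.< m }

data Sign : Set where
  + - : Sign

ω^ : Sign → Ord
ω^ + = ω
ω^ - = ω*

_⊗_ : Ord → Ord → Ord
A ⊗ B = record
  { Carrier = Carrier A × Carrier B
  ; _≈_ = λ { (a , b) (a' , b') → _≈_ A a a' × _≈_ B b b' }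
  ; _<_ = λ { (a , b) (a' , b') → _<_ A a a' ⊎ (_≈_ A a a' × _<_ B b b') }
  }

Finite : Ord → Set
Finite L = ∃ λ (xs : List (Carrier L)) → ∀ z → Any (_≈_ L z) xs

-- rk(L) > 0  iff  L^(0) (= L, classes of equality) is not finite.
RankPositive : Ord → Set
RankPositive L = ¬ Finite L

module _ (L : Ord) where
  private
    _≤_ : Rel (Carrier L) 0ℓ
    x ≤ y = _<_ L x y ⊎ _≈_ L x y

  FinInterval : Carrier L → Carrier L → Set
  FinInterval x y = ∃ λ (xs : List (Carrier L)) →
    ∀ z → x ≤ z → z ≤ y → Any (_≈_ L z) xs

  _~₁_ : Rel (Carrier L) 0ℓ
  x ~₁ y = _≈_ L x y ⊎ (_<_ L x y × FinInterval x y) ⊎ (_<_ L y x × FinInterval y x)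

-- L^(1): the ~₁-classes with the induced order, represented as the
-- setoid (Carrier L, ~₁); a class is below another iff some (equivalently
-- every) representative is below and they are not ~₁-related.
Deriv₁ : Ord → Ord
Deriv₁ L = record
  { Carrier = Carrier L
  ; _≈_ = _~₁_ L
  ; _<_ = λ x y → _<_ L x y × ¬ (_~₁_ L x y)
  }

{-# OPTIONS --safe #-}
-- Since the derivative is invariant under isomorphism, take L = M = ω^δ × L′.
-- Two points of M whose columns differ by at least two have a whole column, a
-- copy of the infinite order L′, between them; so a ~₁-class meets at most two
-- consecutive columns.  Call c ∈ L′ canonical if the class of (0 , c) does not
-- reach column 1.  Shifting columns preserves ~₁, and every class is the shift
-- by n of the class of (0 , c) for exactly one n and one canonical c up to ~₁.
-- Hence M^(1) ≅ ω^δ × L″, where L″ is the set of canonical points ordered as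
-- in M^(1).
module Submission where

open import Defs
open import Level using (0ℓ)
open import Axiom.ExcludedMiddle using (ExcludedMiddle)
open import Data.Empty using (⊥-elim)
open import Data.List using ([]; _∷_; _++_; map)
open import Data.List.Relation.Unary.Any as Any using (here)
open import Data.List.Relation.Unary.Any.Properties using (++⁺ˡ; ++⁺ʳ; map⁺)
open import Data.Nat as ℕ using (ℕ; suc)
import Data.Nat.Properties as ℕₚ
open import Data.Product using (Σ; ∃; _×_; _,_; proj₁; proj₂)
open import Data.Product.Relation.Binary.Lex.Strict using (×-isStrictTotalOrder)
open import Data.Sum using (_⊎_; inj₁; inj₂; [_,_]′)
open import Function using (_∘_)
open import Relation.Binary.Definitions using (Transitive; Trichotomous; tri<; tri≈; tri>)
open import Relation.Binary.Structures using (IsEquivalence; IsPartialOrder; IsStrictTotalOrder)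
import Relation.Binary.Construct.Flip.EqAndOrd as Flip
import Relation.Binary.Construct.On as On
import Relation.Binary.Construct.StrictToNonStrict as StrictToNonStrict
open import Relation.Binary.PropositionalEquality using (_≡_; refl; sym; cong)
open import Relation.Nullary using (¬_; yes; no)

-- ω^ δ with carrier ℕ for every δ, so that column arithmetic typechecks for a
-- variable sign; ω[ + ] and ω[ - ] are definitionally ω and ω*.
_<[_]_ : ℕ → Sign → ℕ → Set
m <[ + ] n = m ℕ.< n
m <[ - ] n = n ℕ.< m

ω[_] : Sign → Ord
ω[ δ ] = record { Carrier = ℕ ; _≈_ = _≡_ ; _<_ = _<[ δ ]_ }

ω[]-isLinear : ∀ δ → IsLinear ω[ δ ]
ω[]-isLinear + = ℕₚ.<-isStrictTotalOrder
ω[]-isLinear - = Flip.isStrictTotalOrder ℕₚ.<-isStrictTotalOrder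

<[]-+-mono : ∀ δ k {m n} → m <[ δ ] n → (m ℕ.+ k) <[ δ ] (n ℕ.+ k)
<[]-+-mono + k = ℕₚ.+-monoˡ-< k
<[]-+-mono - k = ℕₚ.+-monoˡ-< k

<[]-+-cancel : ∀ δ k {m n} → (m ℕ.+ k) <[ δ ] (n ℕ.+ k) → m <[ δ ] n
<[]-+-cancel + k = ℕₚ.+-cancelʳ-< k _ _
<[]-+-cancel - k = ℕₚ.+-cancelʳ-< k _ _

⊗-isLinear : ∀ {A B} → IsLinear A → IsLinear B → IsLinear (A ⊗ B)
⊗-isLinear = ×-isStrictTotalOrder

Induced : (X : Ord) {A : Set} → (A → Carrier X) → Ord
Induced X {A} j = record
  { Carrier = A
  ; _≈_ = λ u v → _≈_ X (j u) (j v)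
  ; _<_ = λ u v → _<_ X (j u) (j v)
  }

Induced-isLinear : ∀ {X A} (j : A → Carrier X) → IsLinear X → IsLinear (Induced X j)
Induced-isLinear j = On.isStrictTotalOrder j

≅-trans : ∀ {A B C} → IsEquivalence (_≈_ C) → A ≅ B → B ≅ C → A ≅ C
≅-trans C-isEquivalence f g = record
  { to = G.to ∘ F.to
  ; ≈⇔ = λ x y → proj₁ (G.≈⇔ _ _) ∘ proj₁ (F.≈⇔ x y) , proj₂ (F.≈⇔ x y) ∘ proj₂ (G.≈⇔ _ _)
  ; <⇔ = λ x y → proj₁ (G.<⇔ _ _) ∘ proj₁ (F.<⇔ x y) , proj₂ (F.<⇔ x y) ∘ proj₂ (G.<⇔ _ _)
  ; surj = λ c → let (b , gb≈c) = G.surj c ; (a , fa≈b) = F.surj b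
                 in a , IsEquivalence.trans C-isEquivalence (proj₁ (G.≈⇔ _ _) fa≈b) gb≈c
  }
  where
  module F = _≅_ f
  module G = _≅_ g

≅-sym : ∀ {A B} → IsLinear B → A ≅ B → B ≅ A
≅-sym B-isLinear f = record
  { to = from
  ; ≈⇔ = λ x y →
      (λ x≈y → proj₂ (≈⇔ _ _) (Eq.trans (to-from x) (Eq.trans x≈y (Eq.sym (to-from y)))))
    , (λ fx≈fy → Eq.trans (Eq.sym (to-from x)) (Eq.trans (proj₁ (≈⇔ _ _) fx≈fy) (to-from y)))
  ; <⇔ = λ x y →
      (λ x<y → proj₂ (<⇔ _ _) (<-respʳ-≈ (Eq.sym (to-from y)) (<-respˡ-≈ (Eq.sym (to-from x)) x<y)))
    , (λ fx<fy → <-respʳ-≈ (to-from y) (<-respˡ-≈ (to-from x) (proj₁ (<⇔ _ _) fx<fy)))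
  ; surj = λ a → to a , proj₂ (≈⇔ _ _) (to-from (to a))
  }
  where
  open _≅_ f
  open IsStrictTotalOrder B-isLinear
  from = proj₁ ∘ surj
  to-from = proj₂ ∘ surj

module Order (X : Ord) where
  open StrictToNonStrict (_≈_ X) (_<_ X) public using (_≤_)

  Between : Carrier X → Carrier X → Carrier X → Set
  Between x w y = (x ≤ w × w ≤ y) ⊎ (y ≤ w × w ≤ x)

  -- Equivalent to ~₁ when X is linear, but symmetric in x and y.
  FinBetween : Carrier X → Carrier X → Set
  FinBetween x y = ∃ λ xs → ∀ w → Between x w y → Any.Any (_≈_ X w) xs

module LinearOrder (X : Ord) (lin : IsLinear X) where
  open Order X public
  open IsStrictTotalOrder lin
  open IsPartialOrder (StrictToNonStrict.isPartialOrder (_≈_ X) (_<_ X) isStrictPartialOrder)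
    using () renaming (trans to ≤-trans; antisym to ≤-antisym; ≲-respʳ-≈ to ≤-respʳ-≈; ≲-respˡ-≈ to ≤-respˡ-≈)

  Between-sym : ∀ {x w y} → Between x w y → Between y w x
  Between-sym (inj₁ b) = inj₂ b
  Between-sym (inj₂ b) = inj₁ b

  Between-ordered : ∀ {x w y} → _<_ X x y → Between x w y → x ≤ w × w ≤ y
  Between-ordered x<y (inj₁ b) = b
  Between-ordered x<y (inj₂ (y≤w , w≤x)) =
    ⊥-elim (irrefl Eq.refl (StrictToNonStrict.≤-<-trans (_≈_ X) (_<_ X) Eq.sym trans <-respˡ-≈ (≤-trans y≤w w≤x) x<y))

  Between-split : ∀ {x w z} y → Between x w z → Between x w y ⊎ Between y w z
  Between-split {w = w} y b with compare w y | b
  ... | tri< w<y _ _ | inj₁ (x≤w , _) = inj₁ (inj₁ (x≤w , inj₁ w<y))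
  ... | tri< w<y _ _ | inj₂ (z≤w , _) = inj₂ (inj₂ (z≤w , inj₁ w<y))
  ... | tri≈ _ w≈y _ | inj₁ (x≤w , _) = inj₁ (inj₁ (x≤w , inj₂ w≈y))
  ... | tri≈ _ w≈y _ | inj₂ (_ , w≤x) = inj₁ (inj₂ (inj₂ (Eq.sym w≈y) , w≤x))
  ... | tri> _ _ y<w | inj₁ (_ , w≤z) = inj₂ (inj₁ (inj₁ y<w , w≤z))
  ... | tri> _ _ y<w | inj₂ (_ , w≤x) = inj₁ (inj₂ (inj₁ y<w , w≤x))

  Between-resp : ∀ {x w w′ y} → _≈_ X w w′ → Between x w y → Between x w′ y
  Between-resp w≈w′ (inj₁ (x≤w , w≤y)) =
    inj₁ (≤-respʳ-≈ w≈w′ x≤w , ≤-respˡ-≈ w≈w′ w≤y)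
  Between-resp w≈w′ (inj₂ (y≤w , w≤x)) =
    inj₂ (≤-respʳ-≈ w≈w′ y≤w , ≤-respˡ-≈ w≈w′ w≤x)

  Between-degenerate : ∀ {x w y} → _≈_ X x y → Between x w y → _≈_ X w x
  Between-degenerate x≈y (inj₁ (x≤w , w≤y)) =
    Eq.sym (≤-antisym x≤w (≤-respʳ-≈ (Eq.sym x≈y) w≤y))
  Between-degenerate x≈y (inj₂ (y≤w , w≤x)) =
    ≤-antisym w≤x (≤-respˡ-≈ (Eq.sym x≈y) y≤w)

  ≈⇒FinBetween : ∀ {x y} → _≈_ X x y → FinBetween x y
  ≈⇒FinBetween {x} x≈y = x ∷ [] , λ w b → here (Between-degenerate x≈y b)

  FinBetween-refl : ∀ x → FinBetween x x
  FinBetween-refl x = ≈⇒FinBetween Eq.refl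

  FinBetween-sym : ∀ {x y} → FinBetween x y → FinBetween y x
  FinBetween-sym (xs , fin) = xs , λ w → fin w ∘ Between-sym

  FinBetween-trans : ∀ {x y z} → FinBetween x y → FinBetween y z → FinBetween x z
  FinBetween-trans {y = y} (xs , finˣ) (ys , finʸ) = xs ++ ys , λ w b →
    [ ++⁺ˡ ∘ finˣ w , ++⁺ʳ xs ∘ finʸ w ]′ (Between-split y b)

  FinBetween-initial : ∀ {x y z} → _<_ X x y → _<_ X y z → FinBetween x z → FinBetween x y
  FinBetween-initial x<y y<z (xs , fin) = xs , λ w b →
    let (x≤w , w≤y) = Between-ordered x<y b in fin w (inj₁ (x≤w , ≤-trans w≤y (inj₁ y<z)))

  FinBetween-final : ∀ {x y z} → _<_ X x y → _<_ X y z → FinBetween x z → FinBetween y z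
  FinBetween-final x<y y<z (xs , fin) = xs , λ w b →
    let (y≤w , w≤z) = Between-ordered y<z b in fin w (inj₁ (≤-trans (inj₁ x<y) y≤w , w≤z))

  ~₁⇒FinBetween : ∀ {x y} → _~₁_ X x y → FinBetween x y
  ~₁⇒FinBetween (inj₁ x≈y) = ≈⇒FinBetween x≈y
  ~₁⇒FinBetween (inj₂ (inj₁ (x<y , xs , fin))) = xs , λ w b →
    let (x≤w , w≤y) = Between-ordered x<y b in fin w x≤w w≤y
  ~₁⇒FinBetween (inj₂ (inj₂ (y<x , xs , fin))) = xs , λ w b →
    let (y≤w , w≤x) = Between-ordered y<x (Between-sym b) in fin w y≤w w≤x

  FinBetween⇒~₁ : ∀ {x y} → FinBetween x y → _~₁_ X x y
  FinBetween⇒~₁ {x} {y} (xs , fin) with compare x y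
  ... | tri< x<y _ _ = inj₂ (inj₁ (x<y , xs , λ w x≤w w≤y → fin w (inj₁ (x≤w , w≤y))))
  ... | tri≈ _ x≈y _ = inj₁ x≈y
  ... | tri> _ _ y<x = inj₂ (inj₂ (y<x , xs , λ w y≤w w≤x → fin w (inj₂ (y≤w , w≤x))))

  ~₁-sym : ∀ {x y} → _~₁_ X x y → _~₁_ X y x
  ~₁-sym = FinBetween⇒~₁ ∘ FinBetween-sym ∘ ~₁⇒FinBetween

  ~₁-trans : ∀ {x y z} → _~₁_ X x y → _~₁_ X y z → _~₁_ X x z
  ~₁-trans x~y y~z = FinBetween⇒~₁ (FinBetween-trans (~₁⇒FinBetween x~y) (~₁⇒FinBetween y~z))

  Deriv₁-isLinear : ExcludedMiddle 0ℓ → IsLinear (Deriv₁ X)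
  Deriv₁-isLinear em = record
    { isStrictPartialOrder = record
      { isEquivalence = record { refl = inj₁ Eq.refl ; sym = ~₁-sym ; trans = ~₁-trans }
      ; irrefl = λ x~y (_ , x≁y) → x≁y x~y
      ; trans = ≺-trans
      ; <-resp-≈ = ≺-respʳ , ≺-respˡ
      }
    ; compare = ≺-compare
    }
    where
    open Ord (Deriv₁ X) using () renaming (_<_ to _≺_)

    ≺-trans : Transitive _≺_
    ≺-trans (x<y , x≁y) (y<z , _) =
      trans x<y y<z , x≁y ∘ FinBetween⇒~₁ ∘ FinBetween-initial x<y y<z ∘ ~₁⇒FinBetween

    ≺-respʳ : ∀ {x y y′} → _~₁_ X y y′ → x ≺ y → x ≺ y′
    ≺-respʳ {x} {y} {y′} y~y′ (x<y , x≁y) with compare x y′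
    ... | tri< x<y′ _ _ = x<y′ , λ x~y′ → x≁y (~₁-trans x~y′ (~₁-sym y~y′))
    ... | tri≈ _ x≈y′ _ = ⊥-elim (x≁y (~₁-trans (inj₁ x≈y′) (~₁-sym y~y′)))
    ... | tri> _ _ y′<x = ⊥-elim (x≁y (FinBetween⇒~₁ (FinBetween-final y′<x x<y (~₁⇒FinBetween (~₁-sym y~y′)))))

    ≺-respˡ : ∀ {y x x′} → _~₁_ X x x′ → x ≺ y → x′ ≺ y
    ≺-respˡ {y} {x} {x′} x~x′ (x<y , x≁y) with compare x′ y
    ... | tri< x′<y _ _ = x′<y , λ x′~y → x≁y (~₁-trans x~x′ x′~y)
    ... | tri≈ _ x′≈y _ = ⊥-elim (x≁y (~₁-trans x~x′ (inj₁ x′≈y)))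
    ... | tri> _ _ y<x′ = ⊥-elim (x≁y (FinBetween⇒~₁ (FinBetween-initial x<y y<x′ (~₁⇒FinBetween x~x′))))

    ≺-compare : Trichotomous (_~₁_ X) _≺_
    ≺-compare x y with em {_~₁_ X x y}
    ... | yes x~y = tri≈ (λ (_ , x≁y) → x≁y x~y) x~y (λ (_ , y≁x) → y≁x (~₁-sym x~y))
    ... | no x≁y with compare x y
    ...   | tri< x<y _ y≮x = tri< (x<y , x≁y) x≁y (y≮x ∘ proj₁)
    ...   | tri≈ _ x≈y _ = ⊥-elim (x≁y (inj₁ x≈y))
    ...   | tri> x≮y _ y<x = tri> (x≮y ∘ proj₁) x≁y (y<x , x≁y ∘ ~₁-sym)

record ConvexEmbedding (X Y : Ord) : Set where
  field
    to      : Carrier X → Carrier Y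
    ≈⇔      : ∀ x y → (_≈_ X x y → _≈_ Y (to x) (to y)) × (_≈_ Y (to x) (to y) → _≈_ X x y)
    <⇔      : ∀ x y → (_<_ X x y → _<_ Y (to x) (to y)) × (_<_ Y (to x) (to y) → _<_ X x y)
    from    : Carrier Y → Carrier X
    to-from : ∀ {x y v} → Order.Between Y (to x) v (to y) → _≈_ Y (to (from v)) v

≅⇒ConvexEmbedding : ∀ {X Y} → X ≅ Y → ConvexEmbedding X Y
≅⇒ConvexEmbedding f = record
  { to = to ; ≈⇔ = ≈⇔ ; <⇔ = <⇔ ; from = proj₁ ∘ surj ; to-from = λ _ → proj₂ (surj _) }
  where open _≅_ f

module ConvexEmbeddingProperties {X Y : Ord} (X-isLinear : IsLinear X) (Y-isLinear : IsLinear Y)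
                                 (e : ConvexEmbedding X Y) where
  open ConvexEmbedding e
  module LX = LinearOrder X X-isLinear
  module LY = LinearOrder Y Y-isLinear
  open IsStrictTotalOrder Y-isLinear using (module Eq)

  ≤-to : ∀ {x y} → x LX.≤ y → to x LY.≤ to y
  ≤-to (inj₁ x<y) = inj₁ (proj₁ (<⇔ _ _) x<y)
  ≤-to (inj₂ x≈y) = inj₂ (proj₁ (≈⇔ _ _) x≈y)

  ≤-from : ∀ {x y} → to x LY.≤ to y → x LX.≤ y
  ≤-from (inj₁ x<y) = inj₁ (proj₂ (<⇔ _ _) x<y)
  ≤-from (inj₂ x≈y) = inj₂ (proj₂ (≈⇔ _ _) x≈y)

  Between-to : ∀ {x w y} → LX.Between x w y → LY.Between (to x) (to w) (to y)
  Between-to (inj₁ (x≤w , w≤y)) = inj₁ (≤-to x≤w , ≤-to w≤y)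
  Between-to (inj₂ (y≤w , w≤x)) = inj₂ (≤-to y≤w , ≤-to w≤x)

  Between-from : ∀ {x w y} → LY.Between (to x) (to w) (to y) → LX.Between x w y
  Between-from (inj₁ (x≤w , w≤y)) = inj₁ (≤-from x≤w , ≤-from w≤y)
  Between-from (inj₂ (y≤w , w≤x)) = inj₂ (≤-from y≤w , ≤-from w≤x)

  FinBetween-to : ∀ {x y} → LX.FinBetween x y → LY.FinBetween (to x) (to y)
  FinBetween-to (xs , fin) = map to xs , λ w b →
    let w≈to-from-w = Eq.sym (to-from b)
        from-w-between = Between-from (LY.Between-resp w≈to-from-w b)
    in map⁺ (Any.map (Eq.trans w≈to-from-w ∘ proj₁ (≈⇔ _ _)) (fin (from w) from-w-between))

  FinBetween-from : ∀ {x y} → LY.FinBetween (to x) (to y) → LX.FinBetween x y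
  FinBetween-from (ys , fin) = map from ys , λ w b →
    let to-w-between = Between-to b
        w≈from : ∀ {v} → _≈_ Y (to w) v → _≈_ X w (from v)
        w≈from to-w≈v = proj₂ (≈⇔ _ _)
          (Eq.trans to-w≈v (Eq.sym (to-from (LY.Between-resp to-w≈v to-w-between))))
    in map⁺ (Any.map w≈from (fin (to w) to-w-between))

  ~₁-to : ∀ {x y} → _~₁_ X x y → _~₁_ Y (to x) (to y)
  ~₁-to = LY.FinBetween⇒~₁ ∘ FinBetween-to ∘ LX.~₁⇒FinBetween

  ~₁-from : ∀ {x y} → _~₁_ Y (to x) (to y) → _~₁_ X x y
  ~₁-from = LX.FinBetween⇒~₁ ∘ FinBetween-from ∘ LY.~₁⇒FinBetween

Deriv₁-cong : ∀ {X Y} → IsLinear X → IsLinear Y → X ≅ Y → Deriv₁ X ≅ Deriv₁ Y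
Deriv₁-cong X-isLinear Y-isLinear f = record
  { to = to
  ; ≈⇔ = λ x y → ~₁-to , ~₁-from
  ; <⇔ = λ x y → (λ (x<y , x≁y) → proj₁ (<⇔ x y) x<y , x≁y ∘ ~₁-from)
               , (λ (x<y , x≁y) → proj₂ (<⇔ x y) x<y , x≁y ∘ ~₁-to)
  ; surj = λ y → let (x , to-x≈y) = surj y in x , inj₁ to-x≈y
  }
  where
  open _≅_ f
  open ConvexEmbeddingProperties X-isLinear Y-isLinear (≅⇒ConvexEmbedding f) using (~₁-to; ~₁-from)

module _ (L′ : Ord) where
  open Order

  column-≤ : ∀ δ {x y} → _≤_ (ω[ δ ] ⊗ L′) x y → _≤_ ω[ δ ] (proj₁ x) (proj₁ y)
  column-≤ δ (inj₁ (inj₁ m<n)) = inj₁ m<n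
  column-≤ δ (inj₁ (inj₂ (m≡n , _))) = inj₂ m≡n
  column-≤ δ (inj₂ (m≡n , _)) = inj₂ m≡n

  upperColumns-convex : ∀ δ {k x w y} → Between (ω[ δ ] ⊗ L′) x w y →
                        k ℕ.≤ proj₁ x → k ℕ.≤ proj₁ y → k ℕ.≤ proj₁ w
  upperColumns-convex δ (inj₁ (x≤w , w≤y)) = ordered δ x≤w w≤y
    where
    ordered : ∀ δ {k x w y} → _≤_ (ω[ δ ] ⊗ L′) x w → _≤_ (ω[ δ ] ⊗ L′) w y →
              k ℕ.≤ proj₁ x → k ℕ.≤ proj₁ y → k ℕ.≤ proj₁ w
    ordered + x≤w _ k≤x _ = ℕₚ.≤-trans k≤x ([ ℕₚ.<⇒≤ , ℕₚ.≤-reflexive ]′ (column-≤ + x≤w))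
    ordered - _ w≤y _ k≤y = ℕₚ.≤-trans k≤y ([ ℕₚ.<⇒≤ , ℕₚ.≤-reflexive ∘ sym ]′ (column-≤ - w≤y))
  upperColumns-convex δ (inj₂ b) k≤x k≤y = upperColumns-convex δ (inj₁ b) k≤y k≤x

  column-between : ∀ δ {n p m a z b} → n ℕ.< p → p ℕ.< m →
                   Between (ω[ δ ] ⊗ L′) (n , a) (p , z) (m , b)
  column-between + n<p p<m = inj₁ (inj₁ (inj₁ n<p) , inj₁ (inj₁ p<m))
  column-between - n<p p<m = inj₂ (inj₁ (inj₁ p<m) , inj₁ (inj₁ n<p))

module Columns (em : ExcludedMiddle 0ℓ) (δ : Sign) (L′ : Ord) (L′-isLinear : IsLinear L′)
               (L′-infinite : RankPositive L′) where

  M : Ord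
  M = ω[ δ ] ⊗ L′

  M-isLinear : IsLinear M
  M-isLinear = ⊗-isLinear (ω[]-isLinear δ) L′-isLinear

  open LinearOrder M M-isLinear
  module L′ = IsStrictTotalOrder L′-isLinear

  shift : ℕ → Carrier M → Carrier M
  shift k (n , a) = n ℕ.+ k , a

  shift-ConvexEmbedding : ℕ → ConvexEmbedding M M
  shift-ConvexEmbedding k = record
    { to = shift k
    ; ≈⇔ = λ _ _ → (λ (m≡n , a≈b) → cong (ℕ._+ k) m≡n , a≈b)
                 , (λ (m≡n , a≈b) → ℕₚ.+-cancelʳ-≡ k _ _ m≡n , a≈b)
    ; <⇔ = λ _ _ → <-shift , <-unshift
    ; from = λ (n , a) → n ℕ.∸ k , a
    ; to-from = λ {(m , _)} {(n , _)} b →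
        ℕₚ.m∸n+n≡m (upperColumns-convex L′ δ b (ℕₚ.m≤n+m k m) (ℕₚ.m≤n+m k n)) , L′.Eq.refl
    }
    where
    <-shift : ∀ {x y} → _<_ M x y → _<_ M (shift k x) (shift k y)
    <-shift (inj₁ m<n) = inj₁ (<[]-+-mono δ k m<n)
    <-shift (inj₂ (m≡n , a<b)) = inj₂ (cong (ℕ._+ k) m≡n , a<b)

    <-unshift : ∀ {x y} → _<_ M (shift k x) (shift k y) → _<_ M x y
    <-unshift (inj₁ m<n) = inj₁ (<[]-+-cancel δ k m<n)
    <-unshift (inj₂ (m≡n , a<b)) = inj₂ (ℕₚ.+-cancelʳ-≡ k _ _ m≡n , a<b)

  module _ (k : ℕ) where
    open ConvexEmbeddingProperties M-isLinear M-isLinear (shift-ConvexEmbedding k) public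
      using () renaming (FinBetween-to to FinBetween-shift; FinBetween-from to FinBetween-unshift)

  ¬FinBetween-acrossColumn : ∀ {n m a b} → suc n ℕ.< m → ¬ FinBetween (n , a) (m , b)
  ¬FinBetween-acrossColumn {n} 1+n<m (xs , fin) = L′-infinite (map proj₂ xs , λ z →
    map⁺ (Any.map proj₂ (fin (suc n , z) (column-between L′ δ (ℕₚ.n<1+n n) 1+n<m))))

  JoinsNextColumn : Carrier L′ → Set
  JoinsNextColumn a = ∃ λ b → FinBetween (0 , a) (1 , b)

  Canonical : Carrier L′ → Set
  Canonical c = ¬ JoinsNextColumn c

  record Representative (a : Carrier L′) : Set where
    field
      column    : ℕ
      point     : Carrier L′
      canonical : Canonical point
      ~point    : FinBetween (0 , a) (column , point)

  representative : ∀ a → Representative a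
  representative a with em {JoinsNextColumn a}
  ... | no ¬joins = record { column = 0 ; point = a ; canonical = ¬joins ; ~point = FinBetween-refl _ }
  ... | yes (b , a~b) = record
    { column = 1
    ; point = b
    ; canonical = λ (c , b~c) →
        ¬FinBetween-acrossColumn (ℕₚ.n<1+n 1) (FinBetween-trans a~b (FinBetween-shift 1 b~c))
    ; ~point = a~b
    }

  canonical-FinBetween : ∀ {p q c d} → Canonical c → Canonical d →
                         FinBetween (p , c) (q , d) → p ≡ q × FinBetween (0 , c) (0 , d)
  canonical-FinBetween {p} {q} {c} {d} c-canonical d-canonical c~d with ℕₚ.<-cmp p q
  ... | tri≈ _ refl _ = refl , FinBetween-unshift p c~d
  ... | tri< p<q _ _ with ℕₚ.m≤n⇒m<n∨m≡n p<q
  ...   | inj₁ 1+p<q = ⊥-elim (¬FinBetween-acrossColumn 1+p<q c~d)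
  ...   | inj₂ refl = ⊥-elim (c-canonical (d , FinBetween-unshift p c~d))
  canonical-FinBetween {p} {q} {c} {d} c-canonical d-canonical c~d | tri> _ _ q<p
    with ℕₚ.m≤n⇒m<n∨m≡n q<p
  ...   | inj₁ 1+q<p = ⊥-elim (¬FinBetween-acrossColumn 1+q<p (FinBetween-sym c~d))
  ...   | inj₂ refl = ⊥-elim (d-canonical (c , FinBetween-unshift q (FinBetween-sym c~d)))

  L″ : Ord
  L″ = Induced (Deriv₁ M) {Σ (Carrier L′) Canonical} (λ (c , _) → 0 , c)

  L″-isLinear : IsLinear L″
  L″-isLinear = Induced-isLinear _ (Deriv₁-isLinear em)

  private
    _~_ = _~₁_ M
    N = ω[ δ ] ⊗ L″
    module ω[δ] = IsStrictTotalOrder (ω[]-isLinear δ)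

  fromCanonical : Carrier N → Carrier M
  fromCanonical (p , c , _) = p , c

  fromCanonical-preserves-~₁ : ∀ u v → _≈_ N u v → fromCanonical u ~ fromCanonical v
  fromCanonical-preserves-~₁ (p , _) _ (refl , c~d) =
    FinBetween⇒~₁ (FinBetween-shift p (~₁⇒FinBetween c~d))

  fromCanonical-reflects-~₁ : ∀ u v → fromCanonical u ~ fromCanonical v → _≈_ N u v
  fromCanonical-reflects-~₁ (_ , _ , c-canonical) (_ , _ , d-canonical) c~d =
    let (p≡q , c~d₀) = canonical-FinBetween c-canonical d-canonical (~₁⇒FinBetween c~d)
    in p≡q , FinBetween⇒~₁ c~d₀

  fromCanonical-preserves-< : ∀ u v → _<_ N u v → _<_ (Deriv₁ M) (fromCanonical u) (fromCanonical v)
  fromCanonical-preserves-< u v (inj₁ p<q) =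
    inj₁ p<q , λ c~d → ω[δ].irrefl (proj₁ (fromCanonical-reflects-~₁ u v c~d)) p<q
  fromCanonical-preserves-< u v (inj₂ (_ , inj₁ 0<0 , _)) = ⊥-elim (ω[δ].irrefl refl 0<0)
  fromCanonical-preserves-< u v (inj₂ (p≡q , inj₂ (_ , c<d) , c≁d)) =
    inj₂ (p≡q , c<d) , c≁d ∘ proj₂ ∘ fromCanonical-reflects-~₁ u v

  fromCanonical-reflects-< : ∀ u v → _<_ (Deriv₁ M) (fromCanonical u) (fromCanonical v) → _<_ N u v
  fromCanonical-reflects-< u v (inj₁ p<q , _) = inj₁ p<q
  fromCanonical-reflects-< u v (inj₂ (p≡q , c<d) , c≁d) =
    inj₂ (p≡q , inj₂ (refl , c<d) , c≁d ∘ fromCanonical-preserves-~₁ u v ∘ (p≡q ,_))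

  fromCanonical-surjective : ∀ x → ∃ λ u → fromCanonical u ~ x
  fromCanonical-surjective (n , a) =
    (column ℕ.+ n , point , canonical) , ~₁-sym (FinBetween⇒~₁ (FinBetween-shift n ~point))
    where open Representative (representative a)

  Deriv₁-≅-ω[]⊗L″ : Deriv₁ M ≅ N
  Deriv₁-≅-ω[]⊗L″ = ≅-sym (Deriv₁-isLinear em) record
    { to = fromCanonical
    ; ≈⇔ = λ u v → fromCanonical-preserves-~₁ u v , fromCanonical-reflects-~₁ u v
    ; <⇔ = λ u v → fromCanonical-preserves-< u v , fromCanonical-reflects-< u v
    ; surj = fromCanonical-surjective
    }

Deriv₁-preserves-ω[]⊗ : ExcludedMiddle 0ℓ → (L : Ord) → IsLinear L →
    (δ : Sign) (L′ : Ord) → IsLinear L′ → RankPositive L′ →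
    L ≅ (ω[ δ ] ⊗ L′) →
    ∃ λ (L″ : Ord) → IsLinear L″ × (Deriv₁ L ≅ (ω[ δ ] ⊗ L″))
Deriv₁-preserves-ω[]⊗ em L L-isLinear δ L′ L′-isLinear L′-infinite L≅M =
  L″ , L″-isLinear ,
  ≅-trans (IsStrictTotalOrder.isEquivalence (⊗-isLinear (ω[]-isLinear δ) L″-isLinear))
          (Deriv₁-cong L-isLinear M-isLinear L≅M)
          Deriv₁-≅-ω[]⊗L″
  where open Columns em δ L′ L′-isLinear L′-infinite

proposition2p7 : ExcludedMiddle 0ℓ →
    (L : Ord) → IsLinear L →
    (δ : Sign) (L′ : Ord) → IsLinear L′ → RankPositive L′ →
    L ≅ (ω^ δ ⊗ L′) →
    ∃ λ (L″ : Ord) → IsLinear L″ × (Deriv₁ L ≅ (ω^ δ ⊗ L″))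
proposition2p7 em L L-isLinear + = Deriv₁-preserves-ω[]⊗ em L L-isLinear +
proposition2p7 em L L-isLinear - = Deriv₁-preserves-ω[]⊗ em L L-isLinear -
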